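{- Let $(G,K,\mathbf{c},\overline{b})$ be a Steiner Tree instance such that no module $M\in\Pi_{mod}(G)$ contains all terminals $K$, and such that $G^q=G/\Pi_{mod}(G)$ is prime. Define the instance $(G^q,K^q,\mathbf{c}^q,\overline{b}^q)$ by $K^q=\pi(K)$, $\mathbf{c}^q(v^q_M)=\mathbf{c}(K\cap M)$ if $K\cap M\ne\emptyset$ and $\mathbf{c}^q(v^q_M)=\min_{v\in M}\mathbf{c}(v)$ otherwise, and $\overline{b}^q=\overline{b}$. Then $(G,K,\mathbf{c},\overline{b})$ is a yes-instance if and only if $(G^q,K^q,\mathbf{c}^q,\overline{b}^q)$ is a yes-instance.
   Context: Steiner Tree: given $G=(V,E)$, $K\subseteq V$, $\mathbf{c}\colon V\to\mathbb{N}\setminus\{0\}$, $\overline{b}$, decide whether there is $X\subseteq V$ with $K\subseteq X$, $G[X]$ connected, and $\mathbf{c}(X)=\sum_{v\in X}\mathbf{c}(v)\le\overline{b}$. A module of $G$ is $M\subseteq V$ with $N(v)\setminus M=N(w)\setminus M$ for all $v,w\in M$; strong if for every module $M'$: $M\cap M'=\emptyset$, $M\subseteq M'$ or $M'\subseteq M$. For $G$ with at least two vertices, $\Pi_{mod}(G)$ is the partition of $V$ into the inclusion-maximal strong modules different from $V$. $G/\Pi_{mod}(G)$ has a vertex $v^q_M$ for each $M\in\Pi_{mod}(G)$ and an edge between $v^q_{M_1}\neq v^q_{M_2}$ iff some edge of $G$ joins $M_1$ and $M_2$; $\pi\colon V\to V(G^q)$ maps $v$ to $v^q_M$ where $v\in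 M$. A graph is prime if its only modules are $\emptyset$, the whole vertex set and singletons. -}

module Defs where

open import Data.Nat using (ℕ; zero; suc; _+_; _⊓_; _≤_; _<_)
open import Data.Bool using (Bool; true; false; _∨_; if_then_else_)
open import Data.Fin using (Fin; zero; suc; _≟_)
open import Data.Fin.Subset public
  using (Subset; _∈_; _∉_; _⊆_; _∩_; ⊤; ⊥; ⁅_⁆; Nonempty; Empty)
open import Data.Vec using (Vec; []; _∷_; tabulate)
open import Data.Maybe using (Maybe; just; nothing; fromMaybe)
open import Data.Product using (Σ; _×_; _,_; ∃; ∃₂)
open import Data.Sum using (_⊎_)
open import Relation.Nullary using (¬_; does)
open import Relation.Binary.PropositionalEquality using (_≡_; _≢_; sym)

record Graph (n : ℕ) : Set₁ where
  field
    E      : Fin n → Fin n → Set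
    E-sym  : ∀ {u v} → E u v → E v u
    E-irr  : ∀ {v} → ¬ E v v
open Graph public

cost : ∀ {n} → Subset n → (Fin n → ℕ) → ℕ
cost []          c = 0
cost (true ∷ X)  c = c zero + cost X (λ v → c (suc v))
cost (false ∷ X) c = cost X (λ v → c (suc v))

minOnM : ∀ {n} → Subset n → (Fin n → ℕ) → Maybe ℕ
minOnM []          c = nothing
minOnM (false ∷ X) c = minOnM X (λ v → c (suc v))
minOnM (true ∷ X)  c with minOnM X (λ v → c (suc v))
... | nothing = just (c zero)
... | just m  = just (c zero ⊓ m)

-- min_{v ∈ X} c(v); only used for nonempty X (value 0 on the empty set)
minOn : ∀ {n} → Subset n → (Fin n → ℕ) → ℕ
minOn X c = fromMaybe 0 (minOnM X c)

anyB : ∀ {n} → Subset n → Bool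
anyB []      = false
anyB (b ∷ X) = b ∨ anyB X

data Reach {n} (G : Graph n) (X : Subset n) : Fin n → Fin n → Set where
  here : ∀ {x} → Reach G X x x
  step : ∀ {x y z} → E G x y → y ∈ X → Reach G X y z → Reach G X x z

Connected : ∀ {n} → Graph n → Subset n → Set
Connected G X = ∀ x y → x ∈ X → y ∈ X → Reach G X x y

YesInstance : ∀ {n} → Graph n → Subset n → (Fin n → ℕ) → ℕ → Set
YesInstance G K c b =
  Σ (Subset _) λ X → K ⊆ X × Connected G X × cost X c ≤ b

IsModule : ∀ {n} → Graph n → Subset n → Set
IsModule G M = ∀ v w u → v ∈ M → w ∈ M → u ∉ M →
  (E G u v → E G u w) × (E G u w → E G u v)

IsStrongModule : ∀ {n} → Graph n → Subset n → Set
IsStrongModule G M = IsModule G M ×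
  (∀ M′ → IsModule G M′ → Empty (M ∩ M′) ⊎ M ⊆ M′ ⊎ M′ ⊆ M)

InPiMod : ∀ {n} → Graph n → Subset n → Set
InPiMod G M = IsStrongModule G M × M ≢ ⊤ ×
  (∀ M′ → IsStrongModule G M′ → M′ ≢ ⊤ → M ⊆ M′ → M′ ≡ M)

IsPrime : ∀ {n} → Graph n → Set
IsPrime {n} G = ∀ M → IsModule G M → M ≡ ⊥ ⊎ M ≡ ⊤ ⊎ ∃ λ v → M ≡ ⁅ v ⁆

-- Quotient by a labelling π : V → Fin k of the parts

fiber : ∀ {n k} → (Fin n → Fin k) → Fin k → Subset n
fiber π i = tabulate (λ v → does (π v ≟ i))

DescribesPiMod : ∀ {n k} → Graph n → (Fin n → Fin k) → Set
DescribesPiMod G π =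
  (∀ i → InPiMod G (fiber π i)) × (∀ M → InPiMod G M → ∃ λ i → M ≡ fiber π i)

quotient : ∀ {n k} → Graph n → (Fin n → Fin k) → Graph k
quotient G π = record
  { E     = λ i j → i ≢ j × ∃₂ λ u v → π u ≡ i × π v ≡ j × E G u v
  ; E-sym = λ { (i≢j , u , v , pu , pv , e) →
               (λ eq → i≢j (sym eq)) , v , u , pv , pu , E-sym G e }
  ; E-irr = λ { (i≢i , _) → i≢i Relation.Binary.PropositionalEquality.refl }
  }

termsQ : ∀ {n k} → (Fin n → Fin k) → Subset n → Subset k
termsQ π K = tabulate (λ i → anyB (K ∩ fiber π i))

costQ : ∀ {n k} → (Fin n → Fin k) → Subset n → (Fin n → ℕ) → Fin k → ℕ
costQ π K c i =
  if anyB (K ∩ fiber π i) then cost (K ∩ fiber π i) c else minOn (fiber π i) c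

-- Every part of Π_mod is a module, so an edge between two parts of the quotient joins every
-- pair of their vertices.  Projecting a solution X gives π(X): it is connected, contains K^q,
-- and each of its parts is paid for by X, which there contains all terminals of the part or
-- at least one vertex, costing at least the minimum.  Conversely, from a quotient solution
-- keep in each selected part its terminals, or its cheapest vertex if it has none; this has
-- cost exactly c^q on every part.  Walks of the quotient lift to walks of G, and two vertices
-- of one part are joined through a neighbouring selected part, which exists because some
-- terminal lies outside that part.
module Submission where

open import Defs
open import Data.Nat using (ℕ; zero; suc; _+_; _⊓_; _≤_; _<_; z≤n; s≤s)
open import Data.Nat.Properties
  using (module ≤-Reasoning; ≤-refl; ≤-trans; ≤-reflexive; +-mono-≤; +-monoʳ-≤; m≤n+m; m⊓n≤m; m⊓n≤n; ⊓-sel; +-identityʳ;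
         +-0-commutativeMonoid)
open import Algebra.Properties.CommutativeMonoid.Sum +-0-commutativeMonoid
  using (sum-syntax; ∑-distrib-+; sum-cong-≗; sum-replicate-zero)
open import Data.Fin using (Fin; zero; suc; _≟_)
open import Data.Fin.Properties using (any?)
open import Data.Fin.Subset using (inside; outside)
open import Data.Fin.Subset.Properties
  using (_∈?_; nonempty?; Empty-unique; drop-∷-⊆; drop-there; x∈⁅x⁆; x∈⁅y⁆⇒x≡y; x∈p∩q⁺; x∈p∩q⁻; p∩q⊆q)
open import Data.Vec using (_∷_; []; lookup; tabulate; here; there)
open import Data.Vec.Properties using ([]=⇒lookup; lookup⇒[]=; lookup∘tabulate)
open import Data.Bool using (Bool; true; false; _∧_; if_then_else_)
open import Data.Maybe using (just; nothing; fromMaybe)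
open import Data.Product using (_×_; _,_; ∃; proj₁; proj₂)
open import Data.Sum using (_⊎_; inj₁; inj₂)
open import Function using (_∘_; id)
open import Function.Bundles using (_⇔_; mk⇔)
open import Relation.Nullary using (¬_; yes; no; does; ¬?; _×-dec_)
open import Relation.Nullary.Decidable using (dec-true)
open import Relation.Nullary.Negation using (contradiction)
open import Relation.Unary using (Pred; Decidable)
open import Relation.Binary.PropositionalEquality
  using (_≡_; _≢_; refl; sym; trans; cong; cong₂; subst; module ≡-Reasoning)

private
  variable
    n k : ℕ

subsetOf : ∀ {p} {P : Pred (Fin n) p} → Decidable P → Subset n
subsetOf P? = tabulate (does ∘ P?)

∈-subsetOf⁺ : ∀ {p} {P : Pred (Fin n) p} (P? : Decidable P) {x} → P x → x ∈ subsetOf P?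
∈-subsetOf⁺ P? {x} px = lookup⇒[]= x _ (trans (lookup∘tabulate (does ∘ P?) x) (dec-true (P? x) px))

∈-subsetOf⁻ : ∀ {p} {P : Pred (Fin n) p} (P? : Decidable P) {x} → x ∈ subsetOf P? → P x
∈-subsetOf⁻ P? {x} x∈ with P? x | trans (sym (lookup∘tabulate (does ∘ P?) x)) ([]=⇒lookup x∈)
... | yes px | _  = px
... | no _   | ()

∈-fiber⁺ : (π : Fin n → Fin k) {v : Fin n} {i : Fin k} → π v ≡ i → v ∈ fiber π i
∈-fiber⁺ π = ∈-subsetOf⁺ (λ v → π v ≟ _)

∈-fiber⁻ : (π : Fin n → Fin k) {v : Fin n} {i : Fin k} → v ∈ fiber π i → π v ≡ i
∈-fiber⁻ π = ∈-subsetOf⁻ (λ v → π v ≟ _)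

anyB⁺ : {p : Subset n} → Nonempty p → anyB p ≡ true
anyB⁺ {p = inside  ∷ p} _                 = refl
anyB⁺ {p = outside ∷ p} (suc x , there x∈) = anyB⁺ (x , x∈)

anyB⁻ : (p : Subset n) → anyB p ≡ true → Nonempty p
anyB⁻ (inside  ∷ p) _ = zero , here
anyB⁻ (outside ∷ p) h with anyB⁻ p h
... | x , x∈ = suc x , there x∈

⊈⇒∃∉ : {p q : Subset n} → ¬ (p ⊆ q) → ∃ λ x → x ∈ p × x ∉ q
⊈⇒∃∉ {p = p} {q} p⊈q with any? (λ x → x ∈? p ×-dec ¬? (x ∈? q))
... | yes (x , x∈p , x∉q) = x , x∈p , x∉q
... | no ∄ = contradiction {A = p ⊆ q} p⊆q p⊈q
  where
  p⊆q : p ⊆ q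
  p⊆q {x} x∈p with x ∈? q
  ... | yes x∈q = x∈q
  ... | no x∉q  = contradiction (x , x∈p , x∉q) ∄

cost-⊥ : (c : Fin n → ℕ) → cost ⊥ c ≡ 0
cost-⊥ {zero}  c = refl
cost-⊥ {suc n} c = cost-⊥ (c ∘ suc)

cost-⁅⁆ : (v : Fin n) (c : Fin n → ℕ) → cost ⁅ v ⁆ c ≡ c v
cost-⁅⁆ zero    c = trans (cong (c zero +_) (cost-⊥ (c ∘ suc))) (+-identityʳ (c zero))
cost-⁅⁆ (suc v) c = cost-⁅⁆ v (c ∘ suc)

cost-mono : {p q : Subset n} (c : Fin n → ℕ) → p ⊆ q → cost p c ≤ cost q c
cost-mono {p = []}          {[]}          c p⊆q = z≤n
cost-mono {p = inside  ∷ p} {inside  ∷ q} c p⊆q = +-monoʳ-≤ (c zero) (cost-mono (c ∘ suc) (drop-∷-⊆ p⊆q))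
cost-mono {p = inside  ∷ p} {outside ∷ q} c p⊆q with p⊆q here
... | ()
cost-mono {p = outside ∷ p} {inside  ∷ q} c p⊆q =
  ≤-trans (cost-mono (c ∘ suc) (drop-∷-⊆ p⊆q)) (m≤n+m _ (c zero))
cost-mono {p = outside ∷ p} {outside ∷ q} c p⊆q = cost-mono (c ∘ suc) (drop-∷-⊆ p⊆q)

∈⇒≤cost : {p : Subset n} (c : Fin n → ℕ) {v : Fin n} → v ∈ p → c v ≤ cost p c
∈⇒≤cost {p = p} c {v} v∈p =
  subst (_≤ cost p c) (cost-⁅⁆ v c) (cost-mono c (λ x∈ → subst (_∈ p) (sym (x∈⁅y⁆⇒x≡y v x∈)) v∈p))

cost-∷ : (b : Bool) (p : Subset n) (c : Fin (suc n) → ℕ) →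
         cost (b ∷ p) c ≡ (if b then c zero else 0) + cost p (c ∘ suc)
cost-∷ true  p c = refl
cost-∷ false p c = refl

∑-indicator : (j : Fin k) (b : Bool) (x : ℕ) →
              ∑[ i < k ] (if b ∧ does (j ≟ i) then x else 0) ≡ (if b then x else 0)
∑-indicator {k}     j       false x = sum-replicate-zero k
∑-indicator {suc k} zero    true  x = trans (cong (x +_) (sum-replicate-zero k)) (+-identityʳ x)
∑-indicator {suc k} (suc j) true  x = ∑-indicator j true x

cost-partition : (π : Fin n → Fin k) (p : Subset n) (c : Fin n → ℕ) →
                 cost p c ≡ ∑[ i < k ] cost (p ∩ fiber π i) c
cost-partition {k = k} π [] c = sym (sum-replicate-zero k)
cost-partition {k = k} π (b ∷ p) c = begin
  cost (b ∷ p) c                                           ≡⟨ cost-∷ b p c ⟩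
  (if b then c zero else 0) + cost p (c ∘ suc)             ≡⟨ cong₂ _+_ (sym (∑-indicator (π zero) b (c zero)))
                                                                        (cost-partition (π ∘ suc) p (c ∘ suc)) ⟩
  ∑[ i < k ] head i + ∑[ i < k ] tail i                    ≡⟨ ∑-distrib-+ head tail ⟨
  ∑[ i < k ] (head i + tail i)                             ≡⟨ sum-cong-≗ (λ i → cost-∷ (b ∧ does (π zero ≟ i)) _ c) ⟨
  ∑[ i < k ] cost ((b ∷ p) ∩ fiber π i) c                  ∎
  where
  open ≡-Reasoning

  head tail : Fin k → ℕ
  head i = if b ∧ does (π zero ≟ i) then c zero else 0
  tail i = cost (p ∩ fiber (π ∘ suc) i) (c ∘ suc)

cost-≤-∑ : (q : Subset k) (d f : Fin k → ℕ) → (∀ {i} → i ∈ q → d i ≤ f i) → cost q d ≤ ∑[ i < k ] f i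
cost-≤-∑ []            d f d≤f = z≤n
cost-≤-∑ (inside  ∷ q) d f d≤f = +-mono-≤ (d≤f here) (cost-≤-∑ q (d ∘ suc) (f ∘ suc) (d≤f ∘ there))
cost-≤-∑ (outside ∷ q) d f d≤f = ≤-trans (cost-≤-∑ q (d ∘ suc) (f ∘ suc) (d≤f ∘ there)) (m≤n+m _ (f zero))

∑-≤-cost : (q : Subset k) (d f : Fin k → ℕ) → (∀ {i} → i ∈ q → f i ≤ d i) → (∀ {i} → i ∉ q → f i ≡ 0) →
           ∑[ i < k ] f i ≤ cost q d
∑-≤-cost []            d f f≤d f≡0 = z≤n
∑-≤-cost (inside  ∷ q) d f f≤d f≡0 =
  +-mono-≤ (f≤d here) (∑-≤-cost q (d ∘ suc) (f ∘ suc) (f≤d ∘ there) (λ i∉q → f≡0 (i∉q ∘ drop-there)))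
∑-≤-cost (outside ∷ q) d f f≤d f≡0 rewrite f≡0 {zero} λ () =
  ∑-≤-cost q (d ∘ suc) (f ∘ suc) (f≤d ∘ there) (λ i∉q → f≡0 (i∉q ∘ drop-there))

minOnM-≤ : (p : Subset n) (c : Fin n → ℕ) {v : Fin n} → v ∈ p → ∃ λ m → minOnM p c ≡ just m × m ≤ c v
minOnM-≤ (inside ∷ p) c here with minOnM p (c ∘ suc)
... | nothing = c zero , refl , ≤-refl
... | just m  = c zero ⊓ m , refl , m⊓n≤m (c zero) m
minOnM-≤ (inside ∷ p) c (there v∈p) with minOnM p (c ∘ suc) | minOnM-≤ p (c ∘ suc) v∈p
... | just m | .m , refl , m≤cv = c zero ⊓ m , refl , ≤-trans (m⊓n≤n (c zero) m) m≤cv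
minOnM-≤ (outside ∷ p) c (there v∈p) = minOnM-≤ p (c ∘ suc) v∈p

minOnM-attained : (p : Subset n) (c : Fin n → ℕ) {m : ℕ} → minOnM p c ≡ just m → ∃ λ u → u ∈ p × m ≡ c u
minOnM-attained (outside ∷ p) c eq with minOnM-attained p (c ∘ suc) eq
... | u , u∈p , m≡cu = suc u , there u∈p , m≡cu
minOnM-attained (inside ∷ p) c eq with minOnM p (c ∘ suc) in eq′
minOnM-attained (inside ∷ p) c refl | nothing = zero , here , refl
minOnM-attained (inside ∷ p) c refl | just m with ⊓-sel (c zero) m
... | inj₁ min≡c0 = zero , here , min≡c0
... | inj₂ min≡m with minOnM-attained p (c ∘ suc) eq′
...   | u , u∈p , m≡cu = suc u , there u∈p , trans min≡m m≡cu

minOn-≤ : (p : Subset n) (c : Fin n → ℕ) {v : Fin n} → v ∈ p → minOn p c ≤ c v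
minOn-≤ p c v∈p with minOnM-≤ p c v∈p
... | m , eq , m≤cv = subst (λ x → fromMaybe 0 x ≤ _) (sym eq) m≤cv

minOn-attained : (p : Subset n) (c : Fin n → ℕ) → Nonempty p → ∃ λ u → u ∈ p × minOn p c ≡ c u
minOn-attained p c (v , v∈p) with minOnM-≤ p c v∈p
... | m , eq , _ with minOnM-attained p c eq
...   | u , u∈p , m≡cu = u , u∈p , trans (cong (fromMaybe 0) eq) m≡cu

⁅⁆-isStrongModule : (G : Graph n) (v : Fin n) → IsStrongModule G ⁅ v ⁆
⁅⁆-isStrongModule G v = isModule , comparable
  where
  isModule : IsModule G ⁅ v ⁆
  isModule x y u x∈ y∈ _ rewrite x∈⁅y⁆⇒x≡y v x∈ | x∈⁅y⁆⇒x≡y v y∈ = id , id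

  comparable : ∀ M → IsModule G M → Empty (⁅ v ⁆ ∩ M) ⊎ ⁅ v ⁆ ⊆ M ⊎ M ⊆ ⁅ v ⁆
  comparable M _ with v ∈? M
  ... | yes v∈M = inj₂ (inj₁ λ x∈ → subst (_∈ M) (sym (x∈⁅y⁆⇒x≡y v x∈)) v∈M)
  ... | no  v∉M = inj₁ λ { (x , x∈) → let x∈⁅v⁆ , x∈M = x∈p∩q⁻ ⁅ v ⁆ M x∈ in
                                       v∉M (subst (_∈ M) (x∈⁅y⁆⇒x≡y v x∈⁅v⁆) x∈M) }

-- An empty member of Π_mod would be properly contained in the strong module ⁅ 0 ⁆ ≠ V.
InPiMod-nonempty : {G : Graph n} {M : Subset n} → 2 ≤ n → InPiMod G M → Nonempty M
InPiMod-nonempty {suc (suc _)} {G} {M} (s≤s (s≤s z≤n)) (_ , _ , maximal) with nonempty? M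
... | yes M≠∅ = M≠∅
... | no  M=∅ = zero , subst (zero ∈_) ⁅0⁆≡M (x∈⁅x⁆ zero)
  where
  ⁅0⁆≡M : ⁅ zero ⁆ ≡ M
  ⁅0⁆≡M = maximal ⁅ zero ⁆ (⁅⁆-isStrongModule G zero) (λ ()) (λ x∈M → contradiction (_ , x∈M) M=∅)

module _ {G : Graph n} {π : Fin n → Fin k} (modular : ∀ i → IsModule G (fiber π i)) where

  -- Adjacency between two modules is all-or-nothing.
  quotient-edge⇒edge : ∀ {i j x y} → E (quotient G π) i j → π x ≡ i → π y ≡ j → E G x y
  quotient-edge⇒edge {i} {j} {x} {y} (i≢j , u , v , πu≡i , πv≡j , uv) πx≡i πy≡j =
    proj₁ (modular j v y x (∈-fiber⁺ π πv≡j) (∈-fiber⁺ π πy≡j) x∉j)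
      (E-sym G (proj₁ (modular i u x v (∈-fiber⁺ π πu≡i) (∈-fiber⁺ π πx≡i) v∉i) (E-sym G uv)))
    where
    v∉i : v ∉ fiber π i
    v∉i v∈i = i≢j (trans (sym (∈-fiber⁻ π v∈i)) πv≡j)
    x∉j : x ∉ fiber π j
    x∉j x∈j = i≢j (trans (sym πx≡i) (∈-fiber⁻ π x∈j))

-- Projecting a solution to the quotient

image : (Fin n → Fin k) → Subset n → Subset k
image = termsQ

module _ (π : Fin n → Fin k) where

  ∈-image⁺ : {X : Subset n} {x : Fin n} → x ∈ X → π x ∈ image π X
  ∈-image⁺ {X} {x} x∈X = lookup⇒[]= (π x) _
    (trans (lookup∘tabulate _ (π x)) (anyB⁺ (x , x∈p∩q⁺ (x∈X , ∈-fiber⁺ π refl))))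

  ∈-image⁻ : (X : Subset n) {i : Fin k} → i ∈ image π X → ∃ λ x → x ∈ X × π x ≡ i
  ∈-image⁻ X {i} i∈ with anyB⁻ (X ∩ fiber π i) (trans (sym (lookup∘tabulate _ i)) ([]=⇒lookup i∈))
  ... | x , x∈ = let x∈X , x∈i = x∈p∩q⁻ X _ x∈ in x , x∈X , ∈-fiber⁻ π x∈i

  image-mono : {X Y : Subset n} → X ⊆ Y → image π X ⊆ image π Y
  image-mono {X} X⊆Y i∈ with ∈-image⁻ X i∈
  ... | x , x∈X , refl = ∈-image⁺ (X⊆Y x∈X)

  reach-image : {G : Graph n} {X : Subset n} {x y : Fin n} →
                Reach G X x y → Reach (quotient G π) (image π X) (π x) (π y)
  reach-image here = here
  reach-image {G} {X} {x} {y} (step {y = z} xz z∈X z⇝y) with π x ≟ π z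
  ... | yes πx≡πz = subst (λ i → Reach (quotient G π) (image π X) i (π y)) (sym πx≡πz) (reach-image z⇝y)
  ... | no  πx≢πz = step (πx≢πz , x , z , refl , refl , xz) (∈-image⁺ z∈X) (reach-image z⇝y)

  connected-image : {G : Graph n} {X : Subset n} → Connected G X → Connected (quotient G π) (image π X)
  connected-image {X = X} X-conn i j i∈ j∈ with ∈-image⁻ X i∈ | ∈-image⁻ X j∈
  ... | x , x∈X , refl | y , y∈X , refl = reach-image (X-conn x y x∈X y∈X)

  costQ-≤-cost : (K X : Subset n) (c : Fin n → ℕ) {i : Fin k} → K ⊆ X → i ∈ image π X →
                 costQ π K c i ≤ cost (X ∩ fiber π i) c
  costQ-≤-cost K X c {i} K⊆X i∈ with anyB (K ∩ fiber π i)
  ... | true  = cost-mono c (λ x∈ → let x∈K , x∈i = x∈p∩q⁻ K _ x∈ in x∈p∩q⁺ (K⊆X x∈K , x∈i))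
  ... | false with ∈-image⁻ X i∈
  ...   | x , x∈X , refl = ≤-trans (minOn-≤ (fiber π (π x)) c (∈-fiber⁺ π refl))
                                   (∈⇒≤cost c (x∈p∩q⁺ (x∈X , ∈-fiber⁺ π refl)))

  solution-image : {G : Graph n} {K : Subset n} {c : Fin n → ℕ} {b : ℕ} →
                   YesInstance G K c b → YesInstance (quotient G π) (termsQ π K) (costQ π K c) b
  solution-image {G} {K} {c} {b} (X , K⊆X , X-conn , cX≤b) =
    image π X , image-mono {K} {X} K⊆X , connected-image {G} {X} X-conn ,
    (begin
      cost (image π X) (costQ π K c)          ≤⟨ cost-≤-∑ (image π X) _ _ (costQ-≤-cost K X c K⊆X) ⟩
      ∑[ i < k ] cost (X ∩ fiber π i) c       ≡⟨ cost-partition π X c ⟨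
      cost X c                                ≤⟨ cX≤b ⟩
      b                                       ∎)
    where open ≤-Reasoning

-- Lifting a quotient solution back to G

Reach⇒neighbour : {G : Graph n} {X : Subset n} {u w : Fin n} → Reach G X u w → u ≢ w → ∃ λ v → E G u v × v ∈ X
Reach⇒neighbour here             u≢u = contradiction refl u≢u
Reach⇒neighbour (step uv v∈X _) _   = _ , uv , v∈X

module Lift {G : Graph n} (K : Subset n) (c : Fin n → ℕ) (π : Fin n → Fin k)
            (modular : ∀ i → IsModule G (fiber π i))
            (inhabited : ∀ i → Nonempty (fiber π i))
            (spread : ∀ i → ¬ (K ⊆ fiber π i)) where

  cheapest : Fin k → Fin n
  cheapest i = proj₁ (minOn-attained (fiber π i) c (inhabited i))

  π-cheapest : ∀ i → π (cheapest i) ≡ i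
  π-cheapest i = ∈-fiber⁻ π (proj₁ (proj₂ (minOn-attained (fiber π i) c (inhabited i))))

  minOn≡cheapest : ∀ i → minOn (fiber π i) c ≡ c (cheapest i)
  minOn≡cheapest i = proj₂ (proj₂ (minOn-attained (fiber π i) c (inhabited i)))

  part : Fin k → Subset n
  part i = if anyB (K ∩ fiber π i) then K ∩ fiber π i else ⁅ cheapest i ⁆

  part⊆fiber : ∀ i → part i ⊆ fiber π i
  part⊆fiber i with anyB (K ∩ fiber π i)
  ... | true  = p∩q⊆q K (fiber π i)
  ... | false = λ x∈ → ∈-fiber⁺ π (trans (cong π (x∈⁅y⁆⇒x≡y _ x∈)) (π-cheapest i))

  part-nonempty : ∀ i → Nonempty (part i)
  part-nonempty i with anyB (K ∩ fiber π i) in has-terminal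
  ... | true  = anyB⁻ (K ∩ fiber π i) has-terminal
  ... | false = cheapest i , x∈⁅x⁆ (cheapest i)

  cost-part : ∀ i → cost (part i) c ≡ costQ π K c i
  cost-part i with anyB (K ∩ fiber π i)
  ... | true  = refl
  ... | false = trans (cost-⁅⁆ (cheapest i) c) (sym (minOn≡cheapest i))

  terminal∈part : ∀ {t} → t ∈ K → t ∈ part (π t)
  terminal∈part {t} t∈K with anyB (K ∩ fiber π (π t)) in has-terminal
  ... | true  = x∈p∩q⁺ (t∈K , ∈-fiber⁺ π refl)
  ... | false with trans (sym has-terminal) (anyB⁺ (t , x∈p∩q⁺ (t∈K , ∈-fiber⁺ π refl)))
  ...   | ()

  lift : Subset k → Subset n
  lift Xq = subsetOf (λ v → π v ∈? Xq ×-dec v ∈? part (π v))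

  module _ {Xq : Subset k} where

    ∈-lift⁺ : ∀ {v} → π v ∈ Xq → v ∈ part (π v) → v ∈ lift Xq
    ∈-lift⁺ πv∈Xq v∈part = ∈-subsetOf⁺ (λ v → π v ∈? Xq ×-dec v ∈? part (π v)) (πv∈Xq , v∈part)

    ∈-lift⁻ : ∀ {v} → v ∈ lift Xq → π v ∈ Xq × v ∈ part (π v)
    ∈-lift⁻ = ∈-subsetOf⁻ (λ v → π v ∈? Xq ×-dec v ∈? part (π v))

    lift-representative : ∀ {i} → i ∈ Xq → ∃ λ x → x ∈ lift Xq × π x ≡ i
    lift-representative {i} i∈Xq with part-nonempty i
    ... | x , x∈part with ∈-fiber⁻ π (part⊆fiber i x∈part)
    ...   | refl = x , ∈-lift⁺ i∈Xq x∈part , refl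

    terminals⊆lift : termsQ π K ⊆ Xq → K ⊆ lift Xq
    terminals⊆lift Kq⊆Xq t∈K = ∈-lift⁺ (Kq⊆Xq (∈-image⁺ π t∈K)) (terminal∈part t∈K)

    connected-lift : Connected (quotient G π) Xq → termsQ π K ⊆ Xq → Connected G (lift Xq)
    connected-lift Xq-conn Kq⊆Xq x y x∈X y∈X =
      walk (Xq-conn (π x) (π y) (proj₁ (∈-lift⁻ x∈X)) (proj₁ (∈-lift⁻ y∈X))) refl refl
      where
      lift-walk : ∀ {u i i′ j} → E (quotient G π) i i′ → i′ ∈ Xq → Reach (quotient G π) Xq i′ j →
                  π u ≡ i → π y ≡ j → Reach G (lift Xq) u y
      lift-walk ii′ _ here πu≡i πy≡j = step (quotient-edge⇒edge {G = G} modular ii′ πu≡i πy≡j) y∈X here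
      lift-walk ii′ i′∈Xq (step i′i″ i″∈Xq i″⇝j) πu≡i πy≡j with lift-representative i′∈Xq
      ... | r , r∈X , πr≡i′ =
        step (quotient-edge⇒edge {G = G} modular ii′ πu≡i πr≡i′) r∈X (lift-walk i′i″ i″∈Xq i″⇝j πr≡i′ πy≡j)

      walk : ∀ {i j} → Reach (quotient G π) Xq i j → π x ≡ i → π y ≡ j → Reach G (lift Xq) x y
      walk (step ii′ i′∈Xq i′⇝j) πx≡i πy≡j = lift-walk ii′ i′∈Xq i′⇝j πx≡i πy≡j
      walk {i} here πx≡i πy≡i = detour (subst (_∈ Xq) πx≡i (proj₁ (∈-lift⁻ x∈X))) (⊈⇒∃∉ (spread i))
        where
        detour : i ∈ Xq → (∃ λ t → t ∈ K × t ∉ fiber π i) → Reach G (lift Xq) x y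
        detour i∈Xq (t , t∈K , t∉i)
          with Reach⇒neighbour (Xq-conn i (π t) i∈Xq (Kq⊆Xq (∈-image⁺ π t∈K)))
                               (λ i≡πt → t∉i (∈-fiber⁺ π (sym i≡πt)))
        ... | i′ , ii′ , i′∈Xq = lift-walk ii′ i′∈Xq (step (E-sym (quotient G π) ii′) i∈Xq here) πx≡i πy≡i

    cost-lift : cost (lift Xq) c ≤ cost Xq (costQ π K c)
    cost-lift = begin
      cost (lift Xq) c                        ≡⟨ cost-partition π (lift Xq) c ⟩
      ∑[ i < k ] cost (lift Xq ∩ fiber π i) c ≤⟨ ∑-≤-cost Xq (costQ π K c) _ selected unselected ⟩
      cost Xq (costQ π K c)                   ∎
      where
      open ≤-Reasoning

      lift∩fiber⊆part : ∀ {i} → lift Xq ∩ fiber π i ⊆ part i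
      lift∩fiber⊆part {i} {x} x∈ =
        let x∈lift , x∈i = x∈p∩q⁻ (lift Xq) (fiber π i) x∈
        in subst (λ j → x ∈ part j) (∈-fiber⁻ π x∈i) (proj₂ (∈-lift⁻ x∈lift))

      selected : ∀ {i} → i ∈ Xq → cost (lift Xq ∩ fiber π i) c ≤ costQ π K c i
      selected {i} _ = ≤-trans (cost-mono c lift∩fiber⊆part) (≤-reflexive (cost-part i))

      unselected : ∀ {i} → i ∉ Xq → cost (lift Xq ∩ fiber π i) c ≡ 0
      unselected {i} i∉Xq = trans (cong (λ p → cost p c) (Empty-unique empty)) (cost-⊥ c)
        where
        empty : Empty (lift Xq ∩ fiber π i)
        empty (x , x∈) =
          let x∈lift , x∈i = x∈p∩q⁻ (lift Xq) (fiber π i) x∈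
          in i∉Xq (subst (_∈ Xq) (∈-fiber⁻ π x∈i) (proj₁ (∈-lift⁻ x∈lift)))

  solution-lift : {b : ℕ} → YesInstance (quotient G π) (termsQ π K) (costQ π K c) b → YesInstance G K c b
  solution-lift (Xq , Kq⊆Xq , Xq-conn , cXq≤b) =
    lift Xq , terminals⊆lift Kq⊆Xq , connected-lift Xq-conn Kq⊆Xq , ≤-trans cost-lift cXq≤b

lemma11 : ∀ {n k} (G : Graph n) (K : Subset n) (c : Fin n → ℕ) (b : ℕ)
    → 2 ≤ n
    → (∀ v → 0 < c v)
    → (π : Fin n → Fin k) → DescribesPiMod G π
    → (∀ i → ¬ (K ⊆ fiber π i))
    → IsPrime (quotient G π)
    → YesInstance G K c b ⇔ YesInstance (quotient G π) (termsQ π K) (costQ π K c) b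
lemma11 G K c b 2≤n _ π (parts , _) spread _ =
  mk⇔ (solution-image π) (Lift.solution-lift K c π modular inhabited spread)
  where
  modular : ∀ i → IsModule G (fiber π i)
  modular i = proj₁ (proj₁ (parts i))

  inhabited : ∀ i → Nonempty (fiber π i)
  inhabited i = InPiMod-nonempty {G = G} 2≤n (parts i)
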